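{- Let $n\ge5$, $3\le m\le n-1$ and $3\le d\le n-\lfloor\frac{m+1}{2}\rfloor$ be integers, let $h=n-d-\lfloor\frac{m+1}{2}\rfloor$, let $a\ge b\ge0$, $a\ge1$ be integers with $a+b=d-\lfloor\frac m2\rfloor$, and let $G=U_{n,m,d}(a,b)$. Then $D_G(v_0)=\lfloor\frac{m^2}{4}\rfloor+\frac12a(a+1)+\frac12b\left(b+1+2\lfloor\frac m2\rfloor\right)+h$, $D_G(v_{\lfloor m/2\rfloor})=\lfloor\frac{m^2}{4}\rfloor+\frac12a\left(a+1+2\lfloor\frac m2\rfloor\right)+\frac12b(b+1)+h\left(1+\lfloor\frac m2\rfloor\right)$, $D_G(u)=\lfloor\frac{m^2}{4}\rfloor+m+\frac12a(a+3)+\frac12b\left(2\lfloor\frac m2\rfloor+b+3\right)+2(h-1)$ for every pendant vertex $u$ adjacent to $v_0$ that is not on the path attached to $v_0$ (when $h\ge1$), $D_G(u_0)=\lfloor\frac{m^2}{4}\rfloor+a\left[\frac12(a-1)+m\right]+\frac12b\left(2a+2\lfloor\frac m2\rfloor+b+1\right)+h(a+1)$, $D_G(u_1)=\lfloor\frac{m^2}{4}\rfloor+b\left[\frac12(b-1)+m\right]+\frac12a\left(2b+2\lfloor\frac m2\rfloor+a+1\right)+h\left(b+\lfloor\frac m2\rfloor+1\right)$.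
   Context: All graphs are finite, simple and connected. For a graph $G$, $d_G(x,y)$ is the distance and $D_G(x)=\sum_{y\in V(G)}d_G(x,y)$. Attaching a path $P_s$ ($s\ge1$) to $w$ means adding new vertices $w_1,\dots,w_s$ with edges $ww_1,w_1w_2,\dots,w_{s-1}w_s$ (nothing for $s=0$); attaching $h$ pendant vertices to $w$ means adding $h$ new vertices each joined only to $w$. $U_{n,m,d}(a,b)$ is the graph obtained from the cycle $C_m=v_0v_1\cdots v_{m-1}v_0$ by attaching a path $P_a$ to $v_0$, a path $P_b$ to $v_{\lfloor m/2\rfloor}$, and $h$ pendant vertices to $v_0$. In $U_{n,m,d}(a,b)$, $u_0$ denotes the end vertex (pendant vertex) of the path attached to $v_0$; $u_1$ denotes the end vertex of the path attached to $v_{\lfloor m/2\rfloor}$ if $b\ge1$, and $u_1=v_{\lfloor m/2\rfloor}$ if $b=0$. -}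

module Defs where

open import Data.Bool using (Bool; true; false; _∨_; _∧_; not)
open import Data.Nat using (ℕ; zero; suc; _+_; _*_; _∸_; _/_; _≡ᵇ_)
open import Data.List using (List; []; _∷_; _++_; map; filter; length; upTo)
open import Data.Bool.ListAction using (any)
open import Data.Nat.ListAction using (sum)
open import Data.Product using (_×_; _,_)
open import Data.Nat using (_≤_)

-- A finite simple graph on the vertex set {0, …, N-1}, given by an edge list.
record Graph : Set where
  constructor graph
  field
    order : ℕ
    edges : List (ℕ × ℕ)
open Graph public

adj : Graph → ℕ → ℕ → Bool
adj G x y = any (λ { (p , q) → ((p ≡ᵇ x) ∧ (q ≡ᵇ y)) ∨ ((p ≡ᵇ y) ∧ (q ≡ᵇ x)) }) (edges G)

ball : Graph → ℕ → ℕ → ℕ → Bool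
ball G zero    x y = x ≡ᵇ y
ball G (suc k) x y = ball G k x y ∨ any (λ z → ball G k x z ∧ adj G z y) (upTo (order G))

-- Graph distance d_G(x,y): the least k with a walk of length ≤ k from x to y.
-- Since ball G k x y is monotone in k, the number of k ∈ {0,…,N-1} with
-- ball G k x y = false is exactly that least k (for a connected graph on N
-- vertices every distance is < N).
dist : Graph → ℕ → ℕ → ℕ
dist G x y = length (Data.List.filter (λ k → Data.Bool.T? (not (ball G k x y))) (upTo (order G)))

D : Graph → ℕ → ℕ
D G x = sum (map (dist G x) (upTo (order G)))

pathEdges : ℕ → ℕ → ℕ → List (ℕ × ℕ)
pathEdges root start zero    = []
pathEdges root start (suc l) = (root , start) ∷ map (λ j → (start + j , start + suc j)) (upTo l)

cycleEdges : ℕ → List (ℕ × ℕ)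
cycleEdges m = (m ∸ 1 , 0) ∷ map (λ i → (i , suc i)) (upTo (m ∸ 1))

hU : ℕ → ℕ → ℕ → ℕ
hU n m d = n ∸ d ∸ ((m + 1) / 2)

-- U_{n,m,d}(a,b) with the labelling:
--   v_i = i                         (0 ≤ i < m)
--   path P_a at v_0                 : vertices m, …, m+a-1   (u_0 = m+a-1)
--   path P_b at v_{⌊m/2⌋}           : vertices m+a, …, m+a+b-1
--   h pendant vertices at v_0       : vertices m+a+b, …, m+a+b+h-1
U : ℕ → ℕ → ℕ → ℕ → ℕ → Graph
U n m d a b = graph n
  (cycleEdges m
   ++ pathEdges 0 m a
   ++ pathEdges (m / 2) (m + a) b
   ++ map (λ j → (0 , m + a + b + j)) (upTo (hU n m d)))

v : ℕ → ℕ
v i = i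

u0 : ℕ → ℕ → ℕ
u0 m a = m + a ∸ 1

u1 : ℕ → ℕ → ℕ → ℕ
u1 m a zero    = m / 2
u1 m a (suc b) = m + a + b

pendant : ℕ → ℕ → ℕ → ℕ → ℕ
pendant m a b j = m + a + b + j

-- The transmission D_G(x) is the sum over all vertices of d_G(x, y), so it suffices to know
-- the distance function from each of the five vertices. For each we write down an explicit
-- candidate (on the cycle min(i, m - i) from v_0 and |i - r| from v_r, shifted by the offset
-- along a path or to a leaf) and certify it: it vanishes at the source, changes by at most one
-- along every edge, and drops by exactly one along some edge at every other vertex, which forces
-- it to be the graph distance. Summing arc by arc gives triangular numbers; the cycle contributes
-- T(r) + T(m - r - 1) = ⌊m²/4⌋ with r = ⌊m/2⌋, and the stated formulas follow by arithmetic.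

module Submission where

open import Defs
open import Data.Bool using (Bool; true; false; not; if_then_else_; T; T?)
open import Data.Bool.Properties using (T-∨; T-∧; T-≡)
open import Data.Empty using (⊥-elim)
open import Data.List using (List; _++_; map; filter; length; upTo; applyUpTo)
open import Data.List.Membership.Propositional using (_∈_; find)
open import Data.List.Membership.Propositional.Properties using (∈-applyUpTo⁺; ∈-map⁺; ∈-++⁺ˡ; ∈-++⁺ʳ)
open import Data.List.Properties using (map-upTo)
open import Data.List.Relation.Unary.All as All using (All; []; _∷_)
import Data.List.Relation.Unary.All.Properties as All
open import Data.List.Relation.Unary.Any as Any using (here; there)
import Data.List.Relation.Unary.Any.Properties as Any
open import Data.Nat
open import Data.Nat.DivMod
open import Data.Nat.ListAction using (sum)
open import Data.Nat.Properties
open import Data.Nat.Tactic.RingSolver using (solve-∀)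
open import Data.Product using (∃; ∃₂; _×_; _,_; proj₁; proj₂; swap)
open import Data.Sum using (_⊎_; inj₁; inj₂; [_,_]′)
open import Data.Unit using (tt)
open import Function using (_∘_; id)
open import Function.Bundles using (Equivalence)
open import Relation.Binary.PropositionalEquality
open import Relation.Binary.Definitions using (tri<; tri≈; tri>)
open import Relation.Nullary using (¬_; yes; no)

open Equivalence using (to; from)

suc[m∸1]≡m : ∀ {m} → 0 < m → suc (m ∸ 1) ≡ m
suc[m∸1]≡m {suc m} _ = refl

<⇒≤∸1 : ∀ {i n} → i < n → i ≤ n ∸ 1
<⇒≤∸1 {n = suc n} (s≤s i≤n) = i≤n

m∸n≤1+m∸[1+n] : ∀ m n → m ∸ n ≤ suc (m ∸ suc n)
m∸n≤1+m∸[1+n] zero    zero    = z≤n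
m∸n≤1+m∸[1+n] zero    (suc n) = z≤n
m∸n≤1+m∸[1+n] (suc m) zero    = ≤-refl
m∸n≤1+m∸[1+n] (suc m) (suc n) = m∸n≤1+m∸[1+n] m n

n*2≡n+n : ∀ n → n * 2 ≡ n + n
n*2≡n+n = solve-∀

<ᵇ-true : ∀ {x y} → x < y → (x <ᵇ y) ≡ true
<ᵇ-true = to T-≡ ∘ <⇒<ᵇ

<ᵇ-false : ∀ {x y} → y ≤ x → (x <ᵇ y) ≡ false
<ᵇ-false {x} {y} y≤x with x <ᵇ y in eq
... | false = refl
... | true  = ⊥-elim (<⇒≱ (<ᵇ⇒< x y (from T-≡ eq)) y≤x)

≡ᵇ-refl : ∀ n → (n ≡ᵇ n) ≡ true
≡ᵇ-refl n = to T-≡ (≡⇒≡ᵇ n n refl)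

∣1+n-n∣≡1 : ∀ n → ∣ suc n - n ∣ ≡ 1
∣1+n-n∣≡1 zero    = refl
∣1+n-n∣≡1 (suc n) = ∣1+n-n∣≡1 n

∣n-r∣≡1+∣1+n-r∣ : ∀ {n r} → n < r → ∣ n - r ∣ ≡ suc ∣ suc n - r ∣
∣n-r∣≡1+∣1+n-r∣ {zero}  {suc r} _        = refl
∣n-r∣≡1+∣1+n-r∣ {suc n} {suc r} (s<s lt) = ∣n-r∣≡1+∣1+n-r∣ lt

∣1+n-r∣≡1+∣n-r∣ : ∀ {n r} → r ≤ n → ∣ suc n - r ∣ ≡ suc ∣ n - r ∣
∣1+n-r∣≡1+∣n-r∣ {zero}  {zero}  _         = refl
∣1+n-r∣≡1+∣n-r∣ {suc n} {zero}  _         = refl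
∣1+n-r∣≡1+∣n-r∣ {suc n} {suc r} (s≤s r≤n) = ∣1+n-r∣≡1+∣n-r∣ r≤n

∣1+r+j-r∣≡1+j : ∀ r j → ∣ suc r + j - r ∣ ≡ suc j
∣1+r+j-r∣≡1+j zero    j = refl
∣1+r+j-r∣≡1+j (suc r) j = ∣1+r+j-r∣≡1+j r j

+-cong₄ : ∀ {x x′ y y′ z z′ w w′} →
          x ≡ x′ → y ≡ y′ → z ≡ z′ → w ≡ w′ → x + y + z + w ≡ x′ + y′ + z′ + w′
+-cong₄ refl refl refl refl = refl

-- Sums over initial segments of ℕ

sumUpTo : (ℕ → ℕ) → ℕ → ℕ
sumUpTo f zero    = 0
sumUpTo f (suc n) = f 0 + sumUpTo (f ∘ suc) n

sum-applyUpTo : ∀ f n → sum (applyUpTo f n) ≡ sumUpTo f n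
sum-applyUpTo f zero    = refl
sum-applyUpTo f (suc n) = cong (f 0 +_) (sum-applyUpTo (f ∘ suc) n)

sumUpTo-cong : ∀ {f g} n → (∀ i → i < n → f i ≡ g i) → sumUpTo f n ≡ sumUpTo g n
sumUpTo-cong zero    f≡g = refl
sumUpTo-cong (suc n) f≡g = cong₂ _+_ (f≡g 0 z<s) (sumUpTo-cong n (λ i i<n → f≡g (suc i) (s<s i<n)))

sumUpTo-split : ∀ f k l → sumUpTo f (k + l) ≡ sumUpTo f k + sumUpTo (λ j → f (k + j)) l
sumUpTo-split f zero    l = refl
sumUpTo-split f (suc k) l =
  trans (cong (f 0 +_) (sumUpTo-split (f ∘ suc) k l)) (sym (+-assoc (f 0) _ _))

sumUpTo-+ : ∀ f g n → sumUpTo (λ i → f i + g i) n ≡ sumUpTo f n + sumUpTo g n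
sumUpTo-+ f g zero    = refl
sumUpTo-+ f g (suc n) =
  trans (cong (f 0 + g 0 +_) (sumUpTo-+ (f ∘ suc) (g ∘ suc) n)) (+-interchange (f 0) (g 0) _ _)
  where
  +-interchange : ∀ w x y z → w + x + (y + z) ≡ w + y + (x + z)
  +-interchange = solve-∀

sumUpTo-const : ∀ k n → sumUpTo (λ _ → k) n ≡ n * k
sumUpTo-const k zero    = refl
sumUpTo-const k (suc n) = cong (k +_) (sumUpTo-const k n)

sumUpTo-+-const : ∀ f k n → sumUpTo (λ i → f i + k) n ≡ sumUpTo f n + n * k
sumUpTo-+-const f k n = trans (sumUpTo-+ f (λ _ → k) n) (cong (sumUpTo f n +_) (sumUpTo-const k n))

sumUpTo-shift : ∀ k f n → sumUpTo (λ i → k + f i) n ≡ n * k + sumUpTo f n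
sumUpTo-shift k f n = trans (sumUpTo-+ (λ _ → k) f n) (cong (_+ sumUpTo f n) (sumUpTo-const k n))

triangle : ℕ → ℕ
triangle zero    = 0
triangle (suc k) = suc k + triangle k

triangle-*2 : ∀ k → triangle k * 2 ≡ k * suc k
triangle-*2 zero    = refl
triangle-*2 (suc k) = begin
  (suc k + triangle k) * 2     ≡⟨ *-distribʳ-+ 2 (suc k) (triangle k) ⟩
  suc k * 2 + triangle k * 2   ≡⟨ cong (suc k * 2 +_) (triangle-*2 k) ⟩
  suc k * 2 + k * suc k        ≡⟨ expand k ⟩
  suc k * suc (suc k)          ∎
  where
  open ≡-Reasoning
  expand : ∀ k → suc k * 2 + k * suc k ≡ suc k * suc (suc k)
  expand = solve-∀

sumUpTo-suc : ∀ k → sumUpTo suc k ≡ triangle k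
sumUpTo-suc zero    = refl
sumUpTo-suc (suc k) =
  cong suc (trans (sumUpTo-shift 1 suc k) (cong₂ _+_ (*-identityʳ k) (sumUpTo-suc k)))

sumUpTo-suc-+ : ∀ k n → sumUpTo (λ i → suc i + k) n ≡ triangle n + n * k
sumUpTo-suc-+ k n = trans (sumUpTo-+-const suc k n) (cong (_+ n * k) (sumUpTo-suc n))

sumUpTo-countdown : ∀ k → sumUpTo (k ∸_) k ≡ triangle k
sumUpTo-countdown zero    = refl
sumUpTo-countdown (suc k) = cong (suc k +_) (sumUpTo-countdown k)

sumUpTo-countdown′ : ∀ k → sumUpTo (k ∸_) (suc k) ≡ triangle k
sumUpTo-countdown′ zero    = refl
sumUpTo-countdown′ (suc k) = cong (suc k +_) (sumUpTo-countdown′ k)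

length-filter-applyUpTo : ∀ (p : ℕ → Bool) g n →
  length (filter (T? ∘ p) (applyUpTo g n)) ≡ sumUpTo (λ i → if p (g i) then 1 else 0) n
length-filter-applyUpTo p g zero    = refl
length-filter-applyUpTo p g (suc n) with p (g 0)
... | true  = cong suc (length-filter-applyUpTo p (g ∘ suc) n)
... | false = length-filter-applyUpTo p (g ∘ suc) n

sumUpTo-indicator-< : ∀ {c n} → c ≤ n → sumUpTo (λ i → if not (c ≤ᵇ i) then 1 else 0) n ≡ c
sumUpTo-indicator-< {c} {n} c≤n = begin
  sumUpTo χ n                                       ≡⟨ cong (sumUpTo χ) (sym (m+[n∸m]≡n c≤n)) ⟩
  sumUpTo χ (c + (n ∸ c))                           ≡⟨ sumUpTo-split χ c (n ∸ c) ⟩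
  sumUpTo χ c + sumUpTo (λ j → χ (c + j)) (n ∸ c)   ≡⟨ cong₂ _+_ (sumUpTo-cong c below) (sumUpTo-cong (n ∸ c) above) ⟩
  sumUpTo (λ _ → 1) c + sumUpTo (λ _ → 0) (n ∸ c)   ≡⟨ cong₂ _+_ (sumUpTo-const 1 c) (sumUpTo-const 0 (n ∸ c)) ⟩
  c * 1 + (n ∸ c) * 0                               ≡⟨ cong₂ _+_ (*-identityʳ c) (*-zeroʳ (n ∸ c)) ⟩
  c + 0                                             ≡⟨ +-identityʳ c ⟩
  c                                                 ∎
  where
  open ≡-Reasoning
  χ : ℕ → ℕ
  χ i = if not (c ≤ᵇ i) then 1 else 0
  below : ∀ i → i < c → χ i ≡ 1
  below i i<c with c ≤ᵇ i in eq
  ... | false = refl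
  ... | true  = ⊥-elim (<⇒≱ i<c (≤ᵇ⇒≤ c i (from T-≡ eq)))
  above : ∀ j → j < n ∸ c → χ (c + j) ≡ 0
  above j _ rewrite to T-≡ (≤⇒≤ᵇ (m≤m+n c j)) = refl

sumUpTo-all-but-one : ∀ k {j n} → j < n → sumUpTo (λ i → if i ≡ᵇ j then 0 else k) n ≡ (n ∸ 1) * k
sumUpTo-all-but-one k {j} {n} j<n = begin
  sumUpTo g n                                            ≡⟨ cong (sumUpTo g) (sym n≡) ⟩
  sumUpTo g (j + suc rest)                               ≡⟨ sumUpTo-split g j (suc rest) ⟩
  sumUpTo g j + (g (j + 0) + sumUpTo (λ i → g (j + suc i)) rest)
    ≡⟨ cong₂ _+_ (sumUpTo-cong j (λ i i<j → off (<⇒≢ i<j)))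
                 (cong₂ _+_ (cong (λ t → if t then 0 else k) (to T-≡ (≡⇒≡ᵇ (j + 0) j (+-identityʳ j))))
                            (sumUpTo-cong rest (λ i _ → off (m+1+n≢m j)))) ⟩
  sumUpTo (λ _ → k) j + (0 + sumUpTo (λ _ → k) rest)     ≡⟨ cong₂ _+_ (sumUpTo-const k j) (sumUpTo-const k rest) ⟩
  j * k + rest * k                                       ≡⟨ sym (*-distribʳ-+ k j rest) ⟩
  (j + rest) * k                                         ≡⟨ cong (λ t → (t ∸ 1) * k) (trans (sym (+-suc j rest)) n≡) ⟩
  (n ∸ 1) * k                                            ∎
  where
  open ≡-Reasoning
  g : ℕ → ℕ
  g i = if i ≡ᵇ j then 0 else k
  rest : ℕ
  rest = n ∸ suc j
  n≡ : j + suc rest ≡ n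
  n≡ = trans (+-suc j rest) (m+[n∸m]≡n j<n)
  off : ∀ {i} → i ≢ j → g i ≡ k
  off {i} i≢j with i ≡ᵇ j in eq
  ... | false = refl
  ... | true  = ⊥-elim (i≢j (≡ᵇ⇒≡ i j (from T-≡ eq)))

-- Certified distances

T-injective : ∀ {b c : Bool} → (T b → T c) → (T c → T b) → b ≡ c
T-injective {true}  {true}  _ _ = refl
T-injective {true}  {false} f _ = ⊥-elim (f tt)
T-injective {false} {true}  _ g = ⊥-elim (g tt)
T-injective {false} {false} _ _ = refl

module DistanceProfile (G : Graph) (x : ℕ) (f : ℕ → ℕ)
  (f-source      : f x ≡ 0)
  (f-lipschitz   : ∀ p q → adj G p q ≡ true → f q ≤ suc (f p))
  (f-predecessor : ∀ y → y < order G → y ≢ x →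
                   ∃ λ z → z < order G × adj G z y ≡ true × f y ≡ suc (f z))
  where

  ball≡ : ∀ k y → y < order G → ball G k x y ≡ (f y ≤ᵇ k)
  ball≡ zero y y<N = T-injective inside outside
    where
    inside : T (x ≡ᵇ y) → T (f y ≤ᵇ 0)
    inside x≡y = ≤⇒≤ᵇ (≤-reflexive (trans (cong f (sym (≡ᵇ⇒≡ x y x≡y))) f-source))
    outside : T (f y ≤ᵇ 0) → T (x ≡ᵇ y)
    outside fy≤0 with y ≟ x
    ... | yes refl = ≡⇒≡ᵇ x x refl
    ... | no y≢x with f-predecessor y y<N y≢x
    ... | _ , _ , _ , fy≡ = ⊥-elim (<⇒≱ (subst (0 <_) (sym fy≡) z<s) (≤ᵇ⇒≤ (f y) 0 fy≤0))
  ball≡ (suc k) y y<N = T-injective inside outside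
    where
    inside : T (ball G (suc k) x y) → T (f y ≤ᵇ suc k)
    inside reached with to T-∨ reached
    ... | inj₁ earlier = ≤⇒≤ᵇ (m≤n⇒m≤1+n (≤ᵇ⇒≤ (f y) k (subst T (ball≡ k y y<N) earlier)))
    ... | inj₂ viaNeighbour
      with All.lookupAny (All.all-upTo (order G)) (Any.any⁻ _ (upTo (order G)) viaNeighbour)
    ... | z<N , step with to T-∧ step
    ... | z-reached , z~y =
      ≤⇒≤ᵇ (≤-trans (f-lipschitz _ y (to T-≡ z~y)) (s≤s (≤ᵇ⇒≤ _ k (subst T (ball≡ k _ z<N) z-reached))))
    outside : T (f y ≤ᵇ suc k) → T (ball G (suc k) x y)
    outside fy≤1+k with m≤n⇒m<n∨m≡n (≤ᵇ⇒≤ (f y) (suc k) fy≤1+k)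
    ... | inj₁ (s≤s fy≤k) = from T-∨ (inj₁ (subst T (sym (ball≡ k y y<N)) (≤⇒≤ᵇ fy≤k)))
    ... | inj₂ fy≡1+k with y ≟ x
    ... | yes refl = ⊥-elim (0≢1+n (trans (sym f-source) fy≡1+k))
    ... | no y≢x with f-predecessor y y<N y≢x
    ... | z , z<N , z~y , fy≡ = from T-∨ (inj₂ (Any.any⁺ _ (Any.applyUpTo⁺ id (from T-∧ (z-reached , from T-≡ z~y)) z<N)))
      where
      z-reached : T (ball G k x z)
      z-reached = subst T (sym (ball≡ k z z<N)) (≤⇒≤ᵇ (≤-reflexive (suc-injective (trans (sym fy≡) fy≡1+k))))

  dist≡ : ∀ y → y < order G → f y ≤ order G → dist G x y ≡ f y
  dist≡ y y<N fy≤N = begin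
    dist G x y
      ≡⟨ length-filter-applyUpTo (λ k → not (ball G k x y)) id (order G) ⟩
    sumUpTo (λ k → if not (ball G k x y) then 1 else 0) (order G)
      ≡⟨ sumUpTo-cong (order G) (λ k _ → cong (λ t → if not t then 1 else 0) (ball≡ k y y<N)) ⟩
    sumUpTo (λ k → if not (f y ≤ᵇ k) then 1 else 0) (order G)
      ≡⟨ sumUpTo-indicator-< fy≤N ⟩
    f y ∎
    where open ≡-Reasoning

  D≡sumUpTo : (∀ y → y < order G → f y ≤ order G) → D G x ≡ sumUpTo f (order G)
  D≡sumUpTo bounded = begin
    sum (map (dist G x) (upTo (order G)))   ≡⟨ cong sum (map-upTo (dist G x) (order G)) ⟩
    sum (applyUpTo (dist G x) (order G))    ≡⟨ sum-applyUpTo (dist G x) (order G) ⟩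
    sumUpTo (dist G x) (order G)            ≡⟨ sumUpTo-cong (order G) (λ y y<N → dist≡ y y<N (bounded y y<N)) ⟩
    sumUpTo f (order G)                     ∎
    where open ≡-Reasoning

adj-complete : ∀ G {x y} → (x , y) ∈ edges G ⊎ (y , x) ∈ edges G → adj G x y ≡ true
adj-complete G {x} {y} (inj₁ xy∈) =
  to T-≡ (Any.any⁺ _ (Any.map (λ { refl → from T-∨ (inj₁ (from T-∧ (≡⇒≡ᵇ x x refl , ≡⇒≡ᵇ y y refl))) }) xy∈))
adj-complete G {x} {y} (inj₂ yx∈) =
  to T-≡ (Any.any⁺ _ (Any.map (λ { refl → from T-∨ (inj₂ (from T-∧ (≡⇒≡ᵇ y y refl , ≡⇒≡ᵇ x x refl))) }) yx∈))

adj-sound : ∀ G {x y} → adj G x y ≡ true → ∃ λ e → e ∈ edges G × (e ≡ (x , y) ⊎ e ≡ (y , x))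
adj-sound G {x} {y} xy with find (Any.any⁻ _ (edges G) (from T-≡ xy))
... | (p , q) , pq∈ , test with to T-∨ test
... | inj₁ t = (p , q) , pq∈ , inj₁ (cong₂ _,_ (≡ᵇ⇒≡ p x (proj₁ (to T-∧ t))) (≡ᵇ⇒≡ q y (proj₂ (to T-∧ t))))
... | inj₂ t = (p , q) , pq∈ , inj₂ (cong₂ _,_ (≡ᵇ⇒≡ p y (proj₁ (to T-∧ t))) (≡ᵇ⇒≡ q x (proj₂ (to T-∧ t))))

ascending : ∀ {x y} → y ≡ suc x → y ≤ suc x × x ≤ suc y
ascending refl = ≤-refl , m≤n⇒m≤1+n (n≤1+n _)

descending : ∀ {x y} → x ≡ suc y → y ≤ suc x × x ≤ suc y
descending x≡1+y = swap (ascending x≡1+y)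

+-lipschitz : ∀ k {x y} → y ≤ suc x × x ≤ suc y → k + y ≤ suc (k + x) × k + x ≤ suc (k + y)
+-lipschitz k {x} {y} (y≤1+x , x≤1+y) =
  ≤-trans (+-monoʳ-≤ k y≤1+x) (≤-reflexive (+-suc k x)) , ≤-trans (+-monoʳ-≤ k x≤1+y) (≤-reflexive (+-suc k y))

cycleDist : ℕ → ℕ → ℕ
cycleDist m i = i ⊓ (m ∸ i)

cycleDist-step : ∀ m i → cycleDist m (suc i) ≤ suc (cycleDist m i) × cycleDist m i ≤ suc (cycleDist m (suc i))
cycleDist-step m i =
  ⊓-monoʳ-≤ (suc i) (≤-trans (∸-monoʳ-≤ m (n≤1+n i)) (n≤1+n _)) ,
  ⊓-mono-≤ (m≤n⇒m≤1+n (n≤1+n i)) (m∸n≤1+m∸[1+n] m i)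

∣-∣-step : ∀ i r → ∣ suc i - r ∣ ≤ suc ∣ i - r ∣ × ∣ i - r ∣ ≤ suc ∣ suc i - r ∣
∣-∣-step i r =
  ≤-trans (∣-∣-triangle (suc i) i r) (≤-reflexive (cong (_+ ∣ i - r ∣) (∣1+n-n∣≡1 i))) ,
  ≤-trans (∣-∣-triangle i (suc i) r) (≤-reflexive (cong (_+ ∣ suc i - r ∣) (trans (∣-∣-comm i (suc i)) (∣1+n-n∣≡1 i))))

-- The graph U_{n,m,d}(a,b) in coordinates

All-pathEdges : ∀ {P : ℕ × ℕ → Set} root start len →
  (0 < len → P (root , start)) → (∀ {i} → suc i < len → P (start + i , start + suc i)) →
  All P (pathEdges root start len)
All-pathEdges root start zero    _     _    = []
All-pathEdges root start (suc l) first next = first z<s ∷ All.map⁺ (All.applyUpTo⁺₁ _ l (next ∘ s<s))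

∈-pathEdges-root : ∀ {root start len} → 0 < len → (root , start) ∈ pathEdges root start len
∈-pathEdges-root {len = suc _} _ = here refl

∈-pathEdges-step : ∀ {root start len i} → suc i < len → (start + i , start + suc i) ∈ pathEdges root start len
∈-pathEdges-step {len = suc _} (s<s i<l) = there (∈-map⁺ _ (∈-applyUpTo⁺ id i<l))

data Pos : Set where
  cyc pathA pathB leaf : ℕ → Pos

module Unicyclic (m r a b h : ℕ) (r<m : r < m) where

  Valid : Pos → Set
  Valid (cyc i)   = i < m
  Valid (pathA i) = i < a
  Valid (pathB i) = i < b
  Valid (leaf i)  = i < h

  encode : Pos → ℕ
  encode (cyc i)   = i
  encode (pathA i) = m + i
  encode (pathB i) = m + a + i
  encode (leaf i)  = m + a + b + i

  decode : ℕ → Pos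
  decode y = if y <ᵇ m then cyc y
             else if y ∸ m <ᵇ a then pathA (y ∸ m)
             else if y ∸ m ∸ a <ᵇ b then pathB (y ∸ m ∸ a)
             else leaf (y ∸ m ∸ a ∸ b)

  infix 4 _⟶_ _~_

  data _⟶_ : Pos → Pos → Set where
    cyc-step  : ∀ {i} → i < m ∸ 1 → cyc i ⟶ cyc (suc i)
    cyc-close : cyc (m ∸ 1) ⟶ cyc 0
    A-root    : 0 < a → cyc 0 ⟶ pathA 0
    A-step    : ∀ {i} → suc i < a → pathA i ⟶ pathA (suc i)
    B-root    : 0 < b → cyc r ⟶ pathB 0
    B-step    : ∀ {i} → suc i < b → pathB i ⟶ pathB (suc i)
    leaf-root : ∀ {i} → i < h → cyc 0 ⟶ leaf i

  _~_ : Pos → Pos → Set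
  P ~ Q = P ⟶ Q ⊎ Q ⟶ P

  N : ℕ
  N = m + a + b + h

  edgeList : List (ℕ × ℕ)
  edgeList = cycleEdges m ++ pathEdges 0 m a ++ pathEdges r (m + a) b ++ map (λ j → (0 , m + a + b + j)) (upTo h)

  graphU : Graph
  graphU = graph N edgeList

  0<m : 0 < m
  0<m = ≤-trans (s≤s z≤n) r<m

  m∸1<m : m ∸ 1 < m
  m∸1<m = ≤-reflexive (suc[m∸1]≡m 0<m)

  ⟶-Valid : ∀ {P Q} → P ⟶ Q → Valid P × Valid Q
  ⟶-Valid (cyc-step i<m∸1) = <-trans i<m∸1 m∸1<m , ≤-trans (s≤s i<m∸1) m∸1<m
  ⟶-Valid cyc-close        = m∸1<m , 0<m
  ⟶-Valid (A-root 0<a)     = 0<m , 0<a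
  ⟶-Valid (A-step i<a)     = <-trans (n<1+n _) i<a , i<a
  ⟶-Valid (B-root 0<b)     = r<m , 0<b
  ⟶-Valid (B-step i<b)     = <-trans (n<1+n _) i<b , i<b
  ⟶-Valid (leaf-root i<h)  = 0<m , i<h

  Encodes : ℕ × ℕ → Set
  Encodes e = ∃₂ λ P Q → P ⟶ Q × e ≡ (encode P , encode Q)

  edgeList-sound : All Encodes edgeList
  edgeList-sound =
    All.++⁺ cycle (All.++⁺ (All-pathEdges 0 m a pathA-root (λ lt → _ , _ , A-step lt , refl))
                  (All.++⁺ (All-pathEdges r (m + a) b pathB-root (λ lt → _ , _ , B-step lt , refl)) leaves))
    where
    cycle : All Encodes (cycleEdges m)
    cycle = (_ , _ , cyc-close , refl) ∷ All.map⁺ (All.applyUpTo⁺₁ _ (m ∸ 1) λ lt → _ , _ , cyc-step lt , refl)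
    pathA-root : 0 < a → Encodes (0 , m)
    pathA-root 0<a = _ , _ , A-root 0<a , cong (0 ,_) (sym (+-identityʳ m))
    pathB-root : 0 < b → Encodes (r , m + a)
    pathB-root 0<b = _ , _ , B-root 0<b , cong (r ,_) (sym (+-identityʳ (m + a)))
    leaves : All Encodes (map (λ j → (0 , m + a + b + j)) (upTo h))
    leaves = All.map⁺ (All.applyUpTo⁺₁ _ h λ lt → _ , _ , leaf-root lt , refl)

  edgeList-complete : ∀ {P Q} → P ⟶ Q → (encode P , encode Q) ∈ edgeList
  edgeList-complete (cyc-step lt) = there (∈-++⁺ˡ (∈-map⁺ _ (∈-applyUpTo⁺ id lt)))
  edgeList-complete cyc-close     = here refl
  edgeList-complete (A-root 0<a)  =
    ∈-++⁺ʳ (cycleEdges m) (∈-++⁺ˡ (subst (λ e → (0 , e) ∈ pathEdges 0 m a) (sym (+-identityʳ m)) (∈-pathEdges-root 0<a)))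
  edgeList-complete (A-step lt)   = ∈-++⁺ʳ (cycleEdges m) (∈-++⁺ˡ (∈-pathEdges-step lt))
  edgeList-complete (B-root 0<b)  =
    ∈-++⁺ʳ (cycleEdges m) (∈-++⁺ʳ (pathEdges 0 m a) (∈-++⁺ˡ
      (subst (λ e → (r , e) ∈ pathEdges r (m + a) b) (sym (+-identityʳ (m + a))) (∈-pathEdges-root 0<b))))
  edgeList-complete (B-step lt)   = ∈-++⁺ʳ (cycleEdges m) (∈-++⁺ʳ (pathEdges 0 m a) (∈-++⁺ˡ (∈-pathEdges-step lt)))
  edgeList-complete (leaf-root lt) =
    ∈-++⁺ʳ (cycleEdges m) (∈-++⁺ʳ (pathEdges 0 m a) (∈-++⁺ʳ (pathEdges r (m + a) b) (∈-map⁺ _ (∈-applyUpTo⁺ id lt))))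

  ~⇒adj : ∀ {P Q} → P ~ Q → adj graphU (encode P) (encode Q) ≡ true
  ~⇒adj (inj₁ P⟶Q) = adj-complete graphU (inj₁ (edgeList-complete P⟶Q))
  ~⇒adj (inj₂ Q⟶P) = adj-complete graphU (inj₂ (edgeList-complete Q⟶P))

  adj⇒~ : ∀ {x y} → adj graphU x y ≡ true → ∃₂ λ P Q → P ~ Q × encode P ≡ x × encode Q ≡ y
  adj⇒~ xy with adj-sound graphU xy
  ... | e , e∈ , e≡ with All.lookup edgeList-sound e∈
  ... | P , Q , P⟶Q , refl with e≡
  ... | inj₁ refl = P , Q , inj₁ P⟶Q , refl , refl
  ... | inj₂ refl = Q , P , inj₂ P⟶Q , refl , refl

  decode-encode : ∀ P → Valid P → decode (encode P) ≡ P
  decode-encode (cyc i) v rewrite <ᵇ-true v = refl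
  decode-encode (pathA i) v rewrite <ᵇ-false (m≤m+n m i) | m+n∸m≡n m i | <ᵇ-true v = refl
  decode-encode (pathB i) v
    rewrite +-assoc m a i | <ᵇ-false (m≤m+n m (a + i)) | m+n∸m≡n m (a + i)
          | <ᵇ-false (m≤m+n a i) | m+n∸m≡n a i | <ᵇ-true v = refl
  decode-encode (leaf i) v
    rewrite +-assoc m a b | +-assoc m (a + b) i | <ᵇ-false (m≤m+n m (a + b + i)) | m+n∸m≡n m (a + b + i)
          | +-assoc a b i | <ᵇ-false (m≤m+n a (b + i)) | m+n∸m≡n a (b + i)
          | <ᵇ-false (m≤m+n b i) | m+n∸m≡n b i = refl

  encode-decode : ∀ y → y < N → Valid (decode y) × encode (decode y) ≡ y
  encode-decode y y<N with y <? m
  ... | yes y<m rewrite <ᵇ-true y<m = y<m , refl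
  ... | no y≮m with y ∸ m <? a | m+[n∸m]≡n (≮⇒≥ y≮m)
  ... | yes y<A | eqA rewrite <ᵇ-false (≮⇒≥ y≮m) | <ᵇ-true y<A = y<A , eqA
  ... | no y≮A | eqA with y ∸ m ∸ a <? b | m+[n∸m]≡n (≮⇒≥ y≮A)
  ... | yes y<B | eqB rewrite <ᵇ-false (≮⇒≥ y≮m) | <ᵇ-false (≮⇒≥ y≮A) | <ᵇ-true y<B =
    y<B , trans (+-assoc m a _) (trans (cong (m +_) eqB) eqA)
  ... | no y≮B | eqB rewrite <ᵇ-false (≮⇒≥ y≮m) | <ᵇ-false (≮⇒≥ y≮A) | <ᵇ-false (≮⇒≥ y≮B) =
    +-cancelˡ-< (m + a + b) _ _ (subst (_< N) (sym encoded) y<N) , encoded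
    where
    encoded : m + a + b + (y ∸ m ∸ a ∸ b) ≡ y
    encoded = trans (+-assoc (m + a) b _) (trans (cong (m + a +_) (m+[n∸m]≡n (≮⇒≥ y≮B)))
                (trans (+-assoc m a _) (trans (cong (m +_) eqB) eqA)))

  encode<N : ∀ P → Valid P → encode P < N
  encode<N (cyc i)   v = ≤-trans v (≤-trans (m≤m+n m a) (≤-trans (m≤m+n (m + a) b) (m≤m+n (m + a + b) h)))
  encode<N (pathA i) v = ≤-trans (+-monoʳ-< m v) (≤-trans (m≤m+n (m + a) b) (m≤m+n (m + a + b) h))
  encode<N (pathB i) v = ≤-trans (+-monoʳ-< (m + a) v) (m≤m+n (m + a + b) h)
  encode<N (leaf i)  v = +-monoʳ-< (m + a + b) v

  record Profile (S : Pos) (F : Pos → ℕ) : Set where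
    field
      source      : F S ≡ 0
      lipschitz   : ∀ {P Q} → P ⟶ Q → F Q ≤ suc (F P) × F P ≤ suc (F Q)
      predecessor : ∀ {P} → Valid P → P ≢ S → ∃ λ Q → Q ~ P × F P ≡ suc (F Q)
      bounded     : ∀ {P} → Valid P → F P ≤ N  -- dist only counts radii below the order

  transmission : ∀ {S F} → Valid S → Profile S F →
    D graphU (encode S) ≡ sumUpTo (F ∘ cyc) m + sumUpTo (F ∘ pathA) a + sumUpTo (F ∘ pathB) b + sumUpTo (F ∘ leaf) h
  transmission {S} {F} S-valid profile = begin
    D graphU (encode S)
      ≡⟨ D≡sumUpTo (λ y y<N → bounded (proj₁ (encode-decode y y<N))) ⟩
    sumUpTo f (m + a + b + h)
      ≡⟨ sumUpTo-split f (m + a + b) h ⟩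
    sumUpTo f (m + a + b) + sumUpTo (λ j → f (m + a + b + j)) h
      ≡⟨ cong (_+ sumUpTo (λ j → f (m + a + b + j)) h) (sumUpTo-split f (m + a) b) ⟩
    sumUpTo f (m + a) + sumUpTo (λ j → f (m + a + j)) b + sumUpTo (λ j → f (m + a + b + j)) h
      ≡⟨ cong (λ s → s + sumUpTo (λ j → f (m + a + j)) b + sumUpTo (λ j → f (m + a + b + j)) h) (sumUpTo-split f m a) ⟩
    sumUpTo f m + sumUpTo (λ j → f (m + j)) a + sumUpTo (λ j → f (m + a + j)) b + sumUpTo (λ j → f (m + a + b + j)) h
      ≡⟨ +-cong₄ (decoded cyc id) (decoded pathA id) (decoded pathB id) (decoded leaf id) ⟩
    sumUpTo (F ∘ cyc) m + sumUpTo (F ∘ pathA) a + sumUpTo (F ∘ pathB) b + sumUpTo (F ∘ leaf) h ∎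
    where
    open ≡-Reasoning
    open Profile profile

    f : ℕ → ℕ
    f = F ∘ decode

    f-encode : ∀ {P} → Valid P → f (encode P) ≡ F P
    f-encode {P} v = cong F (decode-encode P v)

    decoded : ∀ (at : ℕ → Pos) {len} → (∀ {i} → i < len → Valid (at i)) →
              sumUpTo (f ∘ encode ∘ at) len ≡ sumUpTo (F ∘ at) len
    decoded at {len} valid = sumUpTo-cong len (λ i i<len → f-encode (valid i<len))

    f-lipschitz⟶ : ∀ {P Q} → P ⟶ Q → f (encode Q) ≤ suc (f (encode P)) × f (encode P) ≤ suc (f (encode Q))
    f-lipschitz⟶ P⟶Q rewrite f-encode (proj₁ (⟶-Valid P⟶Q)) | f-encode (proj₂ (⟶-Valid P⟶Q)) = lipschitz P⟶Q

    f-lipschitz : ∀ p q → adj graphU p q ≡ true → f q ≤ suc (f p)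
    f-lipschitz p q pq with adj⇒~ pq
    ... | P , Q , inj₁ P⟶Q , refl , refl = proj₁ (f-lipschitz⟶ P⟶Q)
    ... | P , Q , inj₂ Q⟶P , refl , refl = proj₂ (f-lipschitz⟶ Q⟶P)

    f-predecessor : ∀ y → y < N → y ≢ encode S → ∃ λ z → z < N × adj graphU z y ≡ true × f y ≡ suc (f z)
    f-predecessor y y<N y≢S with encode-decode y y<N
    ... | P-valid , encoded with predecessor P-valid (λ P≡S → y≢S (trans (sym encoded) (cong encode P≡S)))
    ... | Q , Q~P , FP≡ =
      encode Q , encode<N Q Q-valid , subst (λ w → adj graphU (encode Q) w ≡ true) encoded (~⇒adj Q~P) ,
      trans FP≡ (cong suc (sym (f-encode Q-valid)))
      where
      Q-valid : Valid Q
      Q-valid = [ proj₁ ∘ ⟶-Valid , proj₂ ∘ ⟶-Valid ]′ Q~P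

    open DistanceProfile graphU (encode S) f ((trans (f-encode S-valid) source)) f-lipschitz f-predecessor using (D≡sumUpTo)

  cyc-step′ : ∀ {i} → suc i < m → cyc i ⟶ cyc (suc i)
  cyc-step′ = cyc-step ∘ <⇒≤∸1

  cyc-close′ : ∀ {i} → suc i ≡ m → cyc i ⟶ cyc 0
  cyc-close′ {i} 1+i≡m = subst (λ k → cyc k ⟶ cyc 0) (suc-injective (trans (suc[m∸1]≡m 0<m) (sym 1+i≡m))) cyc-close

  IsLeaf IsOnA IsOnB : Pos → Set
  IsLeaf P = ∃ λ k → P ≡ leaf k
  IsOnA  P = ∃ λ k → P ≡ pathA k
  IsOnB  P = ∃ λ k → P ≡ pathB k

  leaf-~ : ∀ {P Q} → IsLeaf Q → Q ~ P → P ≡ cyc 0 ⊎ IsLeaf P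
  leaf-~ (_ , refl) (inj₂ (leaf-root _)) = inj₁ refl

  pathA-~ : ∀ {P Q} → IsOnA Q → Q ~ P → P ≡ cyc 0 ⊎ IsOnA P
  pathA-~ (_ , refl) (inj₁ (A-step _)) = inj₂ (_ , refl)
  pathA-~ (_ , refl) (inj₂ (A-root _)) = inj₁ refl
  pathA-~ (_ , refl) (inj₂ (A-step _)) = inj₂ (_ , refl)

  pathB-~ : ∀ {P Q} → IsOnB Q → Q ~ P → P ≡ cyc r ⊎ IsOnB P
  pathB-~ (_ , refl) (inj₁ (B-step _)) = inj₂ (_ , refl)
  pathB-~ (_ , refl) (inj₂ (B-root _)) = inj₁ refl
  pathB-~ (_ , refl) (inj₂ (B-step _)) = inj₂ (_ , refl)

  -- Off a branch meeting the rest of the graph only at S, a profile that is a constant shift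
  -- of the profile from S inherits its predecessors.
  shifted-predecessor : ∀ {S} {F G : Pos → ℕ} {k} (Branch : Pos → Set) →
    (∀ {P Q} → Branch Q → Q ~ P → P ≡ S ⊎ Branch P) → (∀ {P} → ¬ Branch P → G P ≡ k + F P) →
    Profile S F → ∀ {P} → Valid P → P ≢ S → ¬ Branch P → ∃ λ Q → Q ~ P × G P ≡ suc (G Q)
  shifted-predecessor {k = k} Branch closed off profile P-valid P≢S P∉ with Profile.predecessor profile P-valid P≢S
  ... | Q , Q~P , FP≡ = Q , Q~P , trans (off P∉) (trans (cong (k +_) FP≡) (trans (+-suc k _) (cong suc (sym (off Q∉)))))
    where
    Q∉ : ¬ Branch Q
    Q∉ Q∈ = [ P≢S , P∉ ]′ (closed Q∈ Q~P)

-- Distance profiles from v_0, v_r, a pendant leaf, u_0 and u_1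

2+r≤m : ∀ {r m} → r + r ≤ m → 3 ≤ m → 2 + r ≤ m
2+r≤m {zero}        _     3≤m = ≤-trans (s≤s (s≤s z≤n)) 3≤m
2+r≤m {suc zero}    _     3≤m = 3≤m
2+r≤m {suc (suc t)} r+r≤m _   = ≤-trans (s≤s (s≤s (m≤n+m (suc (suc t)) t))) r+r≤m

module Distances (m r a b h : ℕ) (r+r≤m : r + r ≤ m) (m≤1+r+r : m ≤ suc (r + r)) (3≤m : 3 ≤ m) where

  r<m : r < m
  r<m = ≤-trans (n≤1+n _) (2+r≤m r+r≤m 3≤m)

  open Unicyclic m r a b h r<m public

  s : ℕ
  s = m ∸ suc r

  r<m∸1 : r < m ∸ 1
  r<m∸1 = <⇒≤∸1 (2+r≤m r+r≤m 3≤m)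

  s≤r : s ≤ r
  s≤r = ≤-trans (∸-monoˡ-≤ (suc r) m≤1+r+r) (≤-reflexive (m+n∸m≡n r r))

  r≤m∸r : r ≤ m ∸ r
  r≤m∸r = ≤-trans (≤-reflexive (sym (m+n∸m≡n r r))) (∸-monoˡ-≤ r r+r≤m)

  r≤1+s : r ≤ suc s
  r≤1+s = ≤-trans r≤m∸r (≤-reflexive (+-∸-assoc 1 r<m))

  2≤m : 2 ≤ m
  2≤m = ≤-trans (n≤1+n 2) 3≤m

  ≤N : ∀ {x} → x ≤ m → x ≤ N
  ≤N x≤m = ≤-trans x≤m (≤-trans (m≤m+n m a) (≤-trans (m≤m+n (m + a) b) (m≤m+n (m + a + b) h)))

  a+b+≤N : ∀ {x} → x ≤ m → a + (b + x) ≤ N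
  a+b+≤N x≤m = ≤-trans (+-monoʳ-≤ a (+-monoʳ-≤ b x≤m)) (≤-trans (≤-reflexive (regroup a b m)) (m≤m+n (m + a + b) h))
    where
    regroup : ∀ a b m → a + (b + m) ≡ m + a + b
    regroup = solve-∀

  b+a+≤N : ∀ {x} → x ≤ m → b + (a + x) ≤ N
  b+a+≤N {x} x≤m = ≤-trans (≤-reflexive (x+y+z≡y+x+z b a x)) (a+b+≤N x≤m)
    where
    x+y+z≡y+x+z : ∀ x y z → x + (y + z) ≡ y + (x + z)
    x+y+z≡y+x+z = solve-∀

  a+≤N : ∀ {x} → x ≤ m → a + x ≤ N
  a+≤N x≤m = ≤-trans (+-monoʳ-≤ a (m≤n+m _ b)) (a+b+≤N x≤m)

  b+≤N : ∀ {x} → x ≤ m → b + x ≤ N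
  b+≤N x≤m = ≤-trans (+-monoʳ-≤ b (m≤n+m _ a)) (b+a+≤N x≤m)

  d₀ : ℕ → ℕ
  d₀ = cycleDist m

  d₀-lo : ∀ {i} → i ≤ r → d₀ i ≡ i
  d₀-lo i≤r = m≤n⇒m⊓n≡m (≤-trans i≤r (≤-trans r≤m∸r (∸-monoʳ-≤ m i≤r)))

  d₀-hi : ∀ {i} → r < i → d₀ i ≡ m ∸ i
  d₀-hi r<i = m≥n⇒m⊓n≡n (≤-trans (∸-monoʳ-≤ m r<i) (≤-trans s≤r (<⇒≤ r<i)))

  d₀-r : d₀ r ≡ r
  d₀-r = d₀-lo ≤-refl

  d₀-last : d₀ (m ∸ 1) ≡ 1
  d₀-last = trans (d₀-hi r<m∸1) (m∸[m∸n]≡n 0<m)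

  d₀≤m : ∀ {i} → i < m → d₀ i ≤ m
  d₀≤m {i} i<m = ≤-trans (m⊓n≤m i (m ∸ i)) (<⇒≤ i<m)

  dᵣ≤m : ∀ {i} → i < m → ∣ i - r ∣ ≤ m
  dᵣ≤m {i} i<m = ≤-trans (∣m-n∣≤m⊔n i r) (⊔-lub (<⇒≤ i<m) (<⇒≤ r<m))

  ∣m∸1-r∣≡s : ∣ m ∸ 1 - r ∣ ≡ s
  ∣m∸1-r∣≡s = trans (m≤n⇒∣n-m∣≡n∸m (<⇒≤ r<m∸1)) (∸-+-assoc m 1 r)

  F₀ : Pos → ℕ
  F₀ (cyc i)   = d₀ i
  F₀ (pathA i) = suc i
  F₀ (pathB i) = suc i + r
  F₀ (leaf _)  = 1

  lipschitz₀ : ∀ {P Q} → P ⟶ Q → F₀ Q ≤ suc (F₀ P) × F₀ P ≤ suc (F₀ Q)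
  lipschitz₀ (cyc-step {i} _) = cycleDist-step m i
  lipschitz₀ cyc-close        = z≤n , ≤-reflexive d₀-last
  lipschitz₀ (A-root _)       = ascending refl
  lipschitz₀ (A-step _)       = ascending refl
  lipschitz₀ (B-root _)       = ascending (cong suc (sym d₀-r))
  lipschitz₀ (B-step _)       = ascending refl
  lipschitz₀ (leaf-root _)    = ascending refl

  descent₀ : ∀ {i} → r < i → i < m → ∃ λ Q → Q ~ cyc i × d₀ i ≡ suc (F₀ Q)
  descent₀ {i} r<i i<m with suc i <? m
  ... | yes 1+i<m = cyc (suc i) , inj₂ (cyc-step′ 1+i<m) ,
                    trans (d₀-hi r<i) (trans (+-∸-assoc 1 i<m) (cong suc (sym (d₀-hi (m<n⇒m<1+n r<i)))))
  ... | no 1+i≮m  = cyc 0 , inj₂ (cyc-close′ 1+i≡m) ,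
                    trans (d₀-hi r<i) (trans (cong (_∸ i) (sym 1+i≡m)) (m+n∸n≡m 1 i))
    where
    1+i≡m : suc i ≡ m
    1+i≡m = ≤-antisym i<m (≮⇒≥ 1+i≮m)

  predecessor₀ : ∀ {P} → Valid P → P ≢ cyc 0 → ∃ λ Q → Q ~ P × F₀ P ≡ suc (F₀ Q)
  predecessor₀ {cyc zero}    _     P≢0 = ⊥-elim (P≢0 refl)
  predecessor₀ {cyc (suc i)} 1+i<m _ with suc i ≤? r
  ... | yes 1+i≤r = cyc i , inj₁ (cyc-step′ 1+i<m) , trans (d₀-lo 1+i≤r) (cong suc (sym (d₀-lo (<⇒≤ 1+i≤r))))
  ... | no 1+i≰r  = descent₀ (≰⇒> 1+i≰r) 1+i<m
  predecessor₀ {pathA zero}    0<a _ = cyc 0 , inj₁ (A-root 0<a) , refl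
  predecessor₀ {pathA (suc i)} lt  _ = pathA i , inj₁ (A-step lt) , refl
  predecessor₀ {pathB zero}    0<b _ = cyc r , inj₁ (B-root 0<b) , cong suc (sym d₀-r)
  predecessor₀ {pathB (suc i)} lt  _ = pathB i , inj₁ (B-step lt) , refl
  predecessor₀ {leaf i}        lt  _ = cyc 0 , inj₁ (leaf-root lt) , refl

  bounded₀ : ∀ {P} → Valid P → F₀ P ≤ N
  bounded₀ {cyc i}   i<m = ≤N (d₀≤m i<m)
  bounded₀ {pathA i} i<a = ≤-trans (m≤n⇒m≤n+o 0 i<a) (a+≤N z≤n)
  bounded₀ {pathB i} i<b = ≤-trans (+-monoˡ-≤ r i<b) (b+≤N (<⇒≤ r<m))
  bounded₀ {leaf i}  _   = ≤N 0<m

  profile₀ : Profile (cyc 0) F₀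
  profile₀ = record { source = refl ; lipschitz = lipschitz₀ ; predecessor = predecessor₀ ; bounded = bounded₀ }

  Fᵣ : Pos → ℕ
  Fᵣ (cyc i)   = ∣ i - r ∣
  Fᵣ (pathA i) = suc i + r
  Fᵣ (pathB i) = suc i
  Fᵣ (leaf _)  = suc r

  lipschitzᵣ : ∀ {P Q} → P ⟶ Q → Fᵣ Q ≤ suc (Fᵣ P) × Fᵣ P ≤ suc (Fᵣ Q)
  lipschitzᵣ (cyc-step {i} _) = ∣-∣-step i r
  lipschitzᵣ cyc-close        = ≤-trans r≤1+s (≤-reflexive (cong suc (sym ∣m∸1-r∣≡s))) ,
                                ≤-trans (≤-reflexive ∣m∸1-r∣≡s) (m≤n⇒m≤1+n s≤r)
  lipschitzᵣ (A-root _)       = ascending refl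
  lipschitzᵣ (A-step _)       = ascending refl
  lipschitzᵣ (B-root _)       = ascending (cong suc (sym (∣n-n∣≡0 r)))
  lipschitzᵣ (B-step _)       = ascending refl
  lipschitzᵣ (leaf-root _)    = ascending refl

  descentᵣ : ∀ {i} → r < i → i < m → ∃ λ Q → Q ~ cyc i × ∣ i - r ∣ ≡ suc (Fᵣ Q)
  descentᵣ {suc j} (s≤s r≤j) 1+j<m = cyc j , inj₁ (cyc-step′ 1+j<m) , ∣1+n-r∣≡1+∣n-r∣ r≤j

  predecessorᵣ : ∀ {P} → Valid P → P ≢ cyc r → ∃ λ Q → Q ~ P × Fᵣ P ≡ suc (Fᵣ Q)
  predecessorᵣ {cyc i} i<m P≢r with <-cmp i r
  ... | tri< i<r _ _ = cyc (suc i) , inj₂ (cyc-step′ (≤-trans (s≤s i<r) r<m)) , ∣n-r∣≡1+∣1+n-r∣ i<r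
  ... | tri≈ _ i≡r _ = ⊥-elim (P≢r (cong cyc i≡r))
  ... | tri> _ _ r<i = descentᵣ r<i i<m
  predecessorᵣ {pathA zero}    0<a _ = cyc 0 , inj₁ (A-root 0<a) , refl
  predecessorᵣ {pathA (suc i)} lt  _ = pathA i , inj₁ (A-step lt) , refl
  predecessorᵣ {pathB zero}    0<b _ = cyc r , inj₁ (B-root 0<b) , cong suc (sym (∣n-n∣≡0 r))
  predecessorᵣ {pathB (suc i)} lt  _ = pathB i , inj₁ (B-step lt) , refl
  predecessorᵣ {leaf i}        lt  _ = cyc 0 , inj₁ (leaf-root lt) , refl

  boundedᵣ : ∀ {P} → Valid P → Fᵣ P ≤ N
  boundedᵣ {cyc i}   i<m = ≤N (dᵣ≤m i<m)
  boundedᵣ {pathA i} i<a = ≤-trans (+-monoˡ-≤ r i<a) (a+≤N (<⇒≤ r<m))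
  boundedᵣ {pathB i} i<b = ≤-trans (m≤n⇒m≤n+o 0 i<b) (b+≤N z≤n)
  boundedᵣ {leaf i}  _   = ≤N r<m

  profileᵣ : Profile (cyc r) Fᵣ
  profileᵣ = record { source = ∣n-n∣≡0 r ; lipschitz = lipschitzᵣ ; predecessor = predecessorᵣ ; bounded = boundedᵣ }

  Fleaf : ℕ → Pos → ℕ
  Fleaf j (cyc i)   = suc (F₀ (cyc i))
  Fleaf j (pathA i) = suc (F₀ (pathA i))
  Fleaf j (pathB i) = suc (F₀ (pathB i))
  Fleaf j (leaf k)  = if k ≡ᵇ j then 0 else 2

  Fleaf-off : ∀ {j P} → ¬ IsLeaf P → Fleaf j P ≡ 1 + F₀ P
  Fleaf-off {P = cyc _}   _      = refl
  Fleaf-off {P = pathA _} _      = refl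
  Fleaf-off {P = pathB _} _      = refl
  Fleaf-off {P = leaf k}  ¬leaf = ⊥-elim (¬leaf (k , refl))

  lipschitzLeaf : ∀ j {P Q} → P ⟶ Q → Fleaf j Q ≤ suc (Fleaf j P) × Fleaf j P ≤ suc (Fleaf j Q)
  lipschitzLeaf j (leaf-root {k} _) with k ≡ᵇ j
  ... | true  = z≤n , s≤s z≤n
  ... | false = ≤-refl , s≤s z≤n
  lipschitzLeaf j e@(cyc-step _) = +-lipschitz 1 (lipschitz₀ e)
  lipschitzLeaf j e@cyc-close    = +-lipschitz 1 (lipschitz₀ e)
  lipschitzLeaf j e@(A-root _)   = +-lipschitz 1 (lipschitz₀ e)
  lipschitzLeaf j e@(A-step _)   = +-lipschitz 1 (lipschitz₀ e)
  lipschitzLeaf j e@(B-root _)   = +-lipschitz 1 (lipschitz₀ e)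
  lipschitzLeaf j e@(B-step _)   = +-lipschitz 1 (lipschitz₀ e)

  predecessorLeaf : ∀ {j} → j < h → ∀ {P} → Valid P → P ≢ leaf j → ∃ λ Q → Q ~ P × Fleaf j P ≡ suc (Fleaf j Q)
  predecessorLeaf {j} j<h {cyc zero} _ _ =
    leaf j , inj₂ (leaf-root j<h) , cong (λ t → suc (if t then 0 else 2)) (sym (≡ᵇ-refl j))
  predecessorLeaf {j} _ {leaf k} k<h P≢j with k ≡ᵇ j in eq
  ... | false = cyc 0 , inj₁ (leaf-root k<h) , refl
  ... | true  = ⊥-elim (P≢j (cong leaf (≡ᵇ⇒≡ k j (from T-≡ eq))))
  predecessorLeaf _ {cyc (suc i)} v _ = shifted-predecessor IsLeaf leaf-~ Fleaf-off profile₀ v (λ ()) λ { (_ , ()) }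
  predecessorLeaf _ {pathA i}     v _ = shifted-predecessor IsLeaf leaf-~ Fleaf-off profile₀ v (λ ()) λ { (_ , ()) }
  predecessorLeaf _ {pathB i}     v _ = shifted-predecessor IsLeaf leaf-~ Fleaf-off profile₀ v (λ ()) λ { (_ , ()) }

  boundedLeaf : ∀ j {P} → Valid P → Fleaf j P ≤ N
  boundedLeaf j {cyc i}   i<m = ≤N (≤-trans (s≤s (m⊓n≤m i (m ∸ i))) i<m)
  boundedLeaf j {pathA i} i<a = ≤-trans (s≤s i<a) (subst (_≤ N) (+-comm a 1) (a+≤N 0<m))
  boundedLeaf j {pathB i} i<b =
    ≤-trans (≤-reflexive (sym (+-suc (suc i) r))) (≤-trans (+-monoˡ-≤ (suc r) i<b) (b+≤N r<m))
  boundedLeaf j {leaf k}  _   with k ≡ᵇ j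
  ... | true  = z≤n
  ... | false = ≤N 2≤m

  profileLeaf : ∀ {j} → j < h → Profile (leaf j) (Fleaf j)
  profileLeaf {j} j<h = record
    { source      = cong (if_then 0 else 2) (≡ᵇ-refl j)
    ; lipschitz   = lipschitzLeaf j
    ; predecessor = predecessorLeaf j<h
    ; bounded     = boundedLeaf j
    }

  Fu₀ : Pos → ℕ
  Fu₀ (cyc i)   = a + F₀ (cyc i)
  Fu₀ (pathA i) = a ∸ 1 ∸ i
  Fu₀ (pathB i) = a + F₀ (pathB i)
  Fu₀ (leaf i)  = a + F₀ (leaf i)

  Fu₀-off : ∀ {P} → ¬ IsOnA P → Fu₀ P ≡ a + F₀ P
  Fu₀-off {cyc _}   _   = refl
  Fu₀-off {pathA k} ¬onA = ⊥-elim (¬onA (k , refl))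
  Fu₀-off {pathB _} _   = refl
  Fu₀-off {leaf _}  _   = refl

  lipschitzU₀ : ∀ {P Q} → P ⟶ Q → Fu₀ Q ≤ suc (Fu₀ P) × Fu₀ P ≤ suc (Fu₀ Q)
  lipschitzU₀ (A-root 0<a)    = descending (trans (+-identityʳ a) (sym (suc[m∸1]≡m 0<a)))
  lipschitzU₀ (A-step 1+i<a)  = descending (+-∸-assoc 1 (<⇒≤∸1 1+i<a))
  lipschitzU₀ e@(cyc-step _)  = +-lipschitz a (lipschitz₀ e)
  lipschitzU₀ e@cyc-close     = +-lipschitz a (lipschitz₀ e)
  lipschitzU₀ e@(B-root _)    = +-lipschitz a (lipschitz₀ e)
  lipschitzU₀ e@(B-step _)    = +-lipschitz a (lipschitz₀ e)
  lipschitzU₀ e@(leaf-root _) = +-lipschitz a (lipschitz₀ e)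

  predecessorU₀ : 0 < a → ∀ {P} → Valid P → P ≢ pathA (a ∸ 1) → ∃ λ Q → Q ~ P × Fu₀ P ≡ suc (Fu₀ Q)
  predecessorU₀ 0<a {pathA i} i<a P≢end = pathA (suc i) , inj₂ (A-step 1+i<a) , +-∸-assoc 1 i<a∸1
    where
    i<a∸1 : i < a ∸ 1
    i<a∸1 = ≤∧≢⇒< (<⇒≤∸1 i<a) (P≢end ∘ cong pathA)
    1+i<a : suc i < a
    1+i<a = ≤-trans (s≤s i<a∸1) (≤-reflexive (suc[m∸1]≡m 0<a))
  predecessorU₀ 0<a {cyc zero} _ _ =
    pathA 0 , inj₂ (A-root 0<a) , trans (+-identityʳ a) (sym (suc[m∸1]≡m 0<a))
  predecessorU₀ _ {cyc (suc i)} v _ = shifted-predecessor IsOnA pathA-~ Fu₀-off profile₀ v (λ ()) λ { (_ , ()) }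
  predecessorU₀ _ {pathB i}     v _ = shifted-predecessor IsOnA pathA-~ Fu₀-off profile₀ v (λ ()) λ { (_ , ()) }
  predecessorU₀ _ {leaf i}      v _ = shifted-predecessor IsOnA pathA-~ Fu₀-off profile₀ v (λ ()) λ { (_ , ()) }

  boundedU₀ : ∀ {P} → Valid P → Fu₀ P ≤ N
  boundedU₀ {cyc i}   i<m = a+≤N (d₀≤m i<m)
  boundedU₀ {pathA i} _   = ≤-trans (m∸n≤m (a ∸ 1) i) (≤-trans (m∸n≤m a 1) (≤-trans (m≤m+n a 0) (a+≤N z≤n)))
  boundedU₀ {pathB i} i<b = ≤-trans (+-monoʳ-≤ a (+-monoˡ-≤ r i<b)) (a+b+≤N (<⇒≤ r<m))
  boundedU₀ {leaf i}  _   = a+≤N 0<m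

  profileU₀ : 0 < a → Profile (pathA (a ∸ 1)) Fu₀
  profileU₀ 0<a = record
    { source      = n∸n≡0 (a ∸ 1)
    ; lipschitz   = lipschitzU₀
    ; predecessor = predecessorU₀ 0<a
    ; bounded     = boundedU₀
    }

  Fu₁ : Pos → ℕ
  Fu₁ (cyc i)   = b + Fᵣ (cyc i)
  Fu₁ (pathA i) = b + Fᵣ (pathA i)
  Fu₁ (pathB i) = b ∸ 1 ∸ i
  Fu₁ (leaf i)  = b + Fᵣ (leaf i)

  Fu₁-off : ∀ {P} → ¬ IsOnB P → Fu₁ P ≡ b + Fᵣ P
  Fu₁-off {cyc _}   _   = refl
  Fu₁-off {pathA _} _   = refl
  Fu₁-off {pathB k} ¬onB = ⊥-elim (¬onB (k , refl))
  Fu₁-off {leaf _}  _   = refl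

  lipschitzU₁ : ∀ {P Q} → P ⟶ Q → Fu₁ Q ≤ suc (Fu₁ P) × Fu₁ P ≤ suc (Fu₁ Q)
  lipschitzU₁ (B-root 0<b)    =
    descending (trans (cong (b +_) (∣n-n∣≡0 r)) (trans (+-identityʳ b) (sym (suc[m∸1]≡m 0<b))))
  lipschitzU₁ (B-step 1+i<b)  = descending (+-∸-assoc 1 (<⇒≤∸1 1+i<b))
  lipschitzU₁ e@(cyc-step _)  = +-lipschitz b (lipschitzᵣ e)
  lipschitzU₁ e@cyc-close     = +-lipschitz b (lipschitzᵣ e)
  lipschitzU₁ e@(A-root _)    = +-lipschitz b (lipschitzᵣ e)
  lipschitzU₁ e@(A-step _)    = +-lipschitz b (lipschitzᵣ e)
  lipschitzU₁ e@(leaf-root _) = +-lipschitz b (lipschitzᵣ e)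

  predecessorU₁ : 0 < b → ∀ {P} → Valid P → P ≢ pathB (b ∸ 1) → ∃ λ Q → Q ~ P × Fu₁ P ≡ suc (Fu₁ Q)
  predecessorU₁ 0<b {pathB i} i<b P≢end = pathB (suc i) , inj₂ (B-step 1+i<b) , +-∸-assoc 1 i<b∸1
    where
    i<b∸1 : i < b ∸ 1
    i<b∸1 = ≤∧≢⇒< (<⇒≤∸1 i<b) (P≢end ∘ cong pathB)
    1+i<b : suc i < b
    1+i<b = ≤-trans (s≤s i<b∸1) (≤-reflexive (suc[m∸1]≡m 0<b))
  predecessorU₁ 0<b {cyc i} v _ with i ≟ r
  ... | yes refl = pathB 0 , inj₂ (B-root 0<b) ,
                   trans (cong (b +_) (∣n-n∣≡0 r)) (trans (+-identityʳ b) (sym (suc[m∸1]≡m 0<b)))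
  ... | no i≢r   = shifted-predecessor IsOnB pathB-~ Fu₁-off profileᵣ v (λ { refl → i≢r refl }) λ { (_ , ()) }
  predecessorU₁ _ {pathA i} v _ = shifted-predecessor IsOnB pathB-~ Fu₁-off profileᵣ v (λ ()) λ { (_ , ()) }
  predecessorU₁ _ {leaf i}  v _ = shifted-predecessor IsOnB pathB-~ Fu₁-off profileᵣ v (λ ()) λ { (_ , ()) }

  boundedU₁ : ∀ {P} → Valid P → Fu₁ P ≤ N
  boundedU₁ {cyc i}   i<m = b+≤N (dᵣ≤m i<m)
  boundedU₁ {pathA i} i<a = ≤-trans (+-monoʳ-≤ b (+-monoˡ-≤ r i<a)) (b+a+≤N (<⇒≤ r<m))
  boundedU₁ {pathB i} _   = ≤-trans (m∸n≤m (b ∸ 1) i) (≤-trans (m∸n≤m b 1) (≤-trans (m≤m+n b 0) (b+≤N z≤n)))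
  boundedU₁ {leaf i}  _   = b+≤N r<m

  profileU₁ : 0 < b → Profile (pathB (b ∸ 1)) Fu₁
  profileU₁ 0<b = record
    { source      = n∸n≡0 (b ∸ 1)
    ; lipschitz   = lipschitzU₁
    ; predecessor = predecessorU₁ 0<b
    ; bounded     = boundedU₁
    }

  C : ℕ
  C = triangle r + triangle s

  sumUpTo-d₀ : sumUpTo d₀ m ≡ C
  sumUpTo-d₀ = begin
    sumUpTo d₀ m                                           ≡⟨ cong (sumUpTo d₀) (sym (m+[n∸m]≡n r<m)) ⟩
    sumUpTo d₀ (suc r + s)                                 ≡⟨ sumUpTo-split d₀ (suc r) s ⟩
    sumUpTo d₀ (suc r) + sumUpTo (λ j → d₀ (suc r + j)) s  ≡⟨ cong₂ _+_ (sumUpTo-cong (suc r) (λ i i<1+r → d₀-lo (s≤s⁻¹ i<1+r)))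
                                                                        (sumUpTo-cong s (λ j _ → upper j)) ⟩
    sumUpTo id (suc r) + sumUpTo (s ∸_) s                  ≡⟨ cong₂ _+_ (sumUpTo-suc r) (sumUpTo-countdown s) ⟩
    C                                                      ∎
    where
    open ≡-Reasoning
    upper : ∀ j → d₀ (suc r + j) ≡ s ∸ j
    upper j = trans (d₀-hi (s≤s (m≤m+n r j))) (sym (∸-+-assoc m (suc r) j))

  sumUpTo-dᵣ : sumUpTo (λ i → ∣ i - r ∣) m ≡ C
  sumUpTo-dᵣ = begin
    sumUpTo dᵣ m                                           ≡⟨ cong (sumUpTo dᵣ) (sym (m+[n∸m]≡n r<m)) ⟩
    sumUpTo dᵣ (suc r + s)                                 ≡⟨ sumUpTo-split dᵣ (suc r) s ⟩
    sumUpTo dᵣ (suc r) + sumUpTo (λ j → dᵣ (suc r + j)) s  ≡⟨ cong₂ _+_ (sumUpTo-cong (suc r) (λ i i<1+r → m≤n⇒∣m-n∣≡n∸m (s≤s⁻¹ i<1+r)))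
                                                                        (sumUpTo-cong s (λ j _ → ∣1+r+j-r∣≡1+j r j)) ⟩
    sumUpTo (r ∸_) (suc r) + sumUpTo suc s                 ≡⟨ cong₂ _+_ (sumUpTo-countdown′ r) (sumUpTo-suc s) ⟩
    C                                                      ∎
    where
    open ≡-Reasoning
    dᵣ : ℕ → ℕ
    dᵣ i = ∣ i - r ∣

  D-v₀ : D graphU 0 ≡ C + triangle a + (triangle b + b * r) + h * 1
  D-v₀ = trans (transmission 0<m profile₀)
    (+-cong₄ sumUpTo-d₀ (sumUpTo-suc a) (sumUpTo-suc-+ r b) (sumUpTo-const 1 h))

  D-vᵣ : D graphU r ≡ C + (triangle a + a * r) + triangle b + h * suc r
  D-vᵣ = trans (transmission r<m profileᵣ)
    (+-cong₄ sumUpTo-dᵣ (sumUpTo-suc-+ r a) (sumUpTo-suc b) (sumUpTo-const (suc r) h))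

  D-leaf : ∀ {j} → j < h →
    D graphU (m + a + b + j) ≡ (m * 1 + C) + (a * 1 + triangle a) + (b * 1 + (triangle b + b * r)) + (h ∸ 1) * 2
  D-leaf j<h = trans (transmission j<h (profileLeaf j<h))
    (+-cong₄ (trans (sumUpTo-shift 1 d₀ m) (cong (m * 1 +_) sumUpTo-d₀))
             (trans (sumUpTo-shift 1 suc a) (cong (a * 1 +_) (sumUpTo-suc a)))
             (trans (sumUpTo-shift 1 (λ i → suc i + r) b) (cong (b * 1 +_) (sumUpTo-suc-+ r b)))
             (sumUpTo-all-but-one 2 j<h))

  D-u₀ : 0 < a →
    D graphU (m + (a ∸ 1)) ≡ (m * a + C) + triangle (a ∸ 1) + (b * a + (triangle b + b * r)) + h * (a + 1)
  D-u₀ 0<a = trans (transmission (≤-reflexive (suc[m∸1]≡m 0<a)) (profileU₀ 0<a))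
    (+-cong₄ (trans (sumUpTo-shift a d₀ m) (cong (m * a +_) sumUpTo-d₀))
             (trans (cong (sumUpTo (a ∸ 1 ∸_)) (sym (suc[m∸1]≡m 0<a))) (sumUpTo-countdown′ (a ∸ 1)))
             (trans (sumUpTo-shift a (λ i → suc i + r) b) (cong (b * a +_) (sumUpTo-suc-+ r b)))
             (sumUpTo-const (a + 1) h))

  D-u₁ : 0 < b →
    D graphU (m + a + (b ∸ 1)) ≡ (m * b + C) + (a * b + (triangle a + a * r)) + triangle (b ∸ 1) + h * (b + suc r)
  D-u₁ 0<b = trans (transmission (≤-reflexive (suc[m∸1]≡m 0<b)) (profileU₁ 0<b))
    (+-cong₄ (trans (sumUpTo-shift b (λ i → ∣ i - r ∣) m) (cong (m * b +_) sumUpTo-dᵣ))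
             (trans (sumUpTo-shift b (λ i → suc i + r) a) (cong (a * b +_) (sumUpTo-suc-+ r a)))
             (trans (cong (sumUpTo (b ∸ 1 ∸_)) (sym (suc[m∸1]≡m 0<b))) (sumUpTo-countdown′ (b ∸ 1)))
             (sumUpTo-const (b + suc r) h))

-- Floors

half-triangle : ∀ k y {x} → x ≡ k * suc k + y * 2 → x / 2 ≡ triangle k + y
half-triangle k y refl = begin
  (k * suc k + y * 2) / 2           ≡⟨ cong (λ t → (t + y * 2) / 2) (sym (triangle-*2 k)) ⟩
  (triangle k * 2 + y * 2) / 2      ≡⟨ cong (_/ 2) (sym (*-distribʳ-+ 2 (triangle k) y)) ⟩
  (triangle k + y) * 2 / 2          ≡⟨ m*n/n≡m (triangle k + y) 2 ⟩
  triangle k + y                    ∎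
  where open ≡-Reasoning

[1+k*n]/n≡k : ∀ k n → (1 + k * suc (suc n)) / suc (suc n) ≡ k
[1+k*n]/n≡k k n = trans (+-distrib-/ 1 (k * d) 1%d+0<d) (m*n/n≡m k d)
  where
  d = suc (suc n)
  1%d+0<d : 1 % d + (k * d) % d < d
  1%d+0<d = subst (λ t → 1 + t < d) (sym (m*n%n≡0 k d)) (s≤s (s≤s z≤n))

m/2-parity : ∀ m → m ≡ m / 2 + m / 2 ⊎ m ≡ suc (m / 2 + m / 2)
m/2-parity m with m % 2 | m%n<n m 2 | m≡m%n+[m/n]*n m 2
... | zero        | _             | m≡ = inj₁ (trans m≡ (n*2≡n+n (m / 2)))
... | suc zero    | _             | m≡ = inj₂ (trans m≡ (cong suc (n*2≡n+n (m / 2))))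
... | suc (suc _) | s≤s (s≤s ()) | _

m/2-bounds : ∀ m → m / 2 + m / 2 ≤ m × m ≤ suc (m / 2 + m / 2)
m/2-bounds m with m/2-parity m
... | inj₁ even = ≤-reflexive (sym even) , ≤-trans (≤-reflexive even) (n≤1+n _)
... | inj₂ odd  = ≤-trans (n≤1+n _) (≤-reflexive (sym odd)) , ≤-reflexive odd

m/2+[m+1]/2≡m : ∀ m → m / 2 + (m + 1) / 2 ≡ m
m/2+[m+1]/2≡m m with m / 2 | m/2-parity m
... | r | inj₁ refl = cong (r +_) (trans (cong (_/ 2) (r+r+1≡1+r*2 r)) ([1+k*n]/n≡k r 0))
  where
  r+r+1≡1+r*2 : ∀ r → r + r + 1 ≡ 1 + r * 2
  r+r+1≡1+r*2 = solve-∀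
... | r | inj₂ refl = trans (cong (r +_) (trans (cong (_/ 2) (1+r+r+1≡[1+r]*2 r)) (m*n/n≡m (suc r) 2))) (+-suc r r)
  where
  1+r+r+1≡[1+r]*2 : ∀ r → suc (r + r) + 1 ≡ suc r * 2
  1+r+r+1≡[1+r]*2 = solve-∀

triangle+triangle-pred : ∀ k → triangle k + triangle (k ∸ 1) ≡ k * k
triangle+triangle-pred zero    = refl
triangle+triangle-pred (suc t) = begin
  suc t + triangle t + triangle t      ≡⟨ +-assoc (suc t) (triangle t) (triangle t) ⟩
  suc t + (triangle t + triangle t)    ≡⟨ cong (suc t +_) (trans (sym (n*2≡n+n (triangle t))) (triangle-*2 t)) ⟩
  suc t + t * suc t                    ≡⟨ expand t ⟩
  suc t * suc t                        ∎
  where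
  open ≡-Reasoning
  expand : ∀ t → suc t + t * suc t ≡ suc t * suc t
  expand = solve-∀

square/4≡triangles : ∀ m → (m * m) / 4 ≡ triangle (m / 2) + triangle (m ∸ suc (m / 2))
square/4≡triangles m with m / 2 | m/2-parity m
... | r | inj₁ refl = begin
  ((r + r) * (r + r)) / 4              ≡⟨ cong (_/ 4) (square r) ⟩
  (r * r) * 4 / 4                      ≡⟨ m*n/n≡m (r * r) 4 ⟩
  r * r                                ≡⟨ sym (triangle+triangle-pred r) ⟩
  triangle r + triangle (r ∸ 1)        ≡⟨ cong (λ t → triangle r + triangle t) (sym [r+r]∸[1+r]≡r∸1) ⟩
  triangle r + triangle (r + r ∸ suc r) ∎
  where
  open ≡-Reasoning
  square : ∀ r → (r + r) * (r + r) ≡ (r * r) * 4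
  square = solve-∀
  [r+r]∸[1+r]≡r∸1 : r + r ∸ suc r ≡ r ∸ 1
  [r+r]∸[1+r]≡r∸1 = begin
    r + r ∸ suc r    ≡⟨ cong (r + r ∸_) (+-comm 1 r) ⟩
    r + r ∸ (r + 1)  ≡⟨ sym (∸-+-assoc (r + r) r 1) ⟩
    r + r ∸ r ∸ 1    ≡⟨ cong (_∸ 1) (m+n∸m≡n r r) ⟩
    r ∸ 1            ∎
... | r | inj₂ refl = begin
  (suc (r + r) * suc (r + r)) / 4      ≡⟨ cong (_/ 4) (square r) ⟩
  (1 + (r * suc r) * 4) / 4            ≡⟨ [1+k*n]/n≡k (r * suc r) 2 ⟩
  r * suc r                            ≡⟨ sym (triangle-*2 r) ⟩
  triangle r * 2                       ≡⟨ n*2≡n+n (triangle r) ⟩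
  triangle r + triangle r              ≡⟨ cong (λ t → triangle r + triangle t) (sym (m+n∸m≡n r r)) ⟩
  triangle r + triangle (r + r ∸ r)    ∎
  where
  open ≡-Reasoning
  square : ∀ r → suc (r + r) * suc (r + r) ≡ 1 + (r * suc r) * 4
  square = solve-∀

order-U : ∀ {n m d a b} → 0 < d → d ≤ n ∸ (m + 1) / 2 → 0 < a + b → a + b ≡ d ∸ m / 2 →
          m + a + b + hU n m d ≡ n
order-U {n} {m} {d} {a} {b} 0<d d≤n∸c 0<a+b a+b≡ = begin
  m + a + b + hU n m d       ≡⟨ cong (λ t → t + a + b + hU n m d) (sym (m/2+[m+1]/2≡m m)) ⟩
  r + c + a + b + hU n m d   ≡⟨ regroup r c a b (hU n m d) ⟩
  c + (r + (a + b) + hU n m d) ≡⟨ cong (λ t → c + (t + hU n m d)) (trans (cong (r +_) a+b≡) (m+[n∸m]≡n r≤d)) ⟩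
  c + (d + (n ∸ d ∸ c))      ≡⟨ cong (λ t → c + (d + t)) (∸-swap n d c) ⟩
  c + (d + (n ∸ c ∸ d))      ≡⟨ cong (c +_) (m+[n∸m]≡n d≤n∸c) ⟩
  c + (n ∸ c)                ≡⟨ m+[n∸m]≡n c≤n ⟩
  n                          ∎
  where
  open ≡-Reasoning
  r c : ℕ
  r = m / 2
  c = (m + 1) / 2
  regroup : ∀ r c a b h → r + c + a + b + h ≡ c + (r + (a + b) + h)
  regroup = solve-∀
  ∸-swap : ∀ n d c → n ∸ d ∸ c ≡ n ∸ c ∸ d
  ∸-swap n d c = trans (∸-+-assoc n d c) (trans (cong (n ∸_) (+-comm d c)) (sym (∸-+-assoc n c d)))
  r≤d : r ≤ d
  r≤d = <⇒≤ (m∸n≢0⇒n<m (λ d∸r≡0 → <⇒≢ 0<a+b (sym (trans a+b≡ d∸r≡0))))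
  c≤n : c ≤ n
  c≤n = <⇒≤ (m∸n≢0⇒n<m (λ n∸c≡0 → <⇒≢ (≤-trans 0<d d≤n∸c) (sym n∸c≡0)))

-- The five transmissions

module ClosedForms (n m d a₀ b : ℕ) (3≤m : 3 ≤ m) (3≤d : 3 ≤ d) (d≤n∸c : d ≤ n ∸ (m + 1) / 2)
                   (a+b≡ : suc a₀ + b ≡ d ∸ m / 2) where

  a r h q : ℕ
  a = suc a₀
  r = m / 2
  h = hU n m d
  q = (m * m) / 4

  open Distances m r a b h (proj₁ (m/2-bounds m)) (proj₂ (m/2-bounds m)) 3≤m public

  D-U : ∀ x → D (U n m d a b) x ≡ D graphU x
  D-U x = cong (λ k → D (graph k edgeList) x) (sym N≡n)
    where
    N≡n : m + a + b + h ≡ n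
    N≡n = order-U {n} {m} {d} {a} {b} (≤-trans (s≤s z≤n) 3≤d) d≤n∸c (s≤s z≤n) a+b≡

  q≡C : q ≡ C
  q≡C = square/4≡triangles m

  transmission-v₀ : D (U n m d a b) (v 0) ≡ q + (a * (a + 1)) / 2 + (b * (b + 1 + 2 * r)) / 2 + h
  transmission-v₀ = begin
    D (U n m d a b) 0                                      ≡⟨ trans (D-U 0) D-v₀ ⟩
    C + triangle a + (triangle b + b * r) + h * 1          ≡⟨ regroup C (triangle a) (triangle b + b * r) h ⟩
    C + (triangle a + 0) + (triangle b + b * r) + h
      ≡⟨ sym (+-cong₄ q≡C (half-triangle a 0 (expandA a)) (half-triangle b (b * r) (expandB b r)) refl) ⟩
    q + (a * (a + 1)) / 2 + (b * (b + 1 + 2 * r)) / 2 + h  ∎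
    where
    open ≡-Reasoning
    regroup : ∀ C x y h → C + x + y + h * 1 ≡ C + (x + 0) + y + h
    regroup = solve-∀
    expandA : ∀ a → a * (a + 1) ≡ a * suc a + 0 * 2
    expandA = solve-∀
    expandB : ∀ b r → b * (b + 1 + 2 * r) ≡ b * suc b + b * r * 2
    expandB = solve-∀

  transmission-vᵣ : D (U n m d a b) (v r) ≡ q + (a * (a + 1 + 2 * r)) / 2 + (b * (b + 1)) / 2 + h * (1 + r)
  transmission-vᵣ = begin
    D (U n m d a b) r                                      ≡⟨ trans (D-U r) D-vᵣ ⟩
    C + (triangle a + a * r) + triangle b + h * suc r
      ≡⟨ cong (λ t → C + (triangle a + a * r) + t + h * suc r) (sym (+-identityʳ (triangle b))) ⟩
    C + (triangle a + a * r) + (triangle b + 0) + h * suc r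
      ≡⟨ sym (+-cong₄ q≡C (half-triangle a (a * r) (expandA a r)) (half-triangle b 0 (expandB b)) refl) ⟩
    q + (a * (a + 1 + 2 * r)) / 2 + (b * (b + 1)) / 2 + h * (1 + r) ∎
    where
    open ≡-Reasoning
    expandA : ∀ a r → a * (a + 1 + 2 * r) ≡ a * suc a + a * r * 2
    expandA = solve-∀
    expandB : ∀ b → b * (b + 1) ≡ b * suc b + 0 * 2
    expandB = solve-∀

  transmission-leaf : ∀ j → j < h →
    D (U n m d a b) (pendant m a b j) ≡ q + m + (a * (a + 3)) / 2 + (b * (2 * r + b + 3)) / 2 + 2 * (h ∸ 1)
  transmission-leaf j j<h = begin
    D (U n m d a b) (m + a + b + j)                        ≡⟨ trans (D-U _) (D-leaf j<h) ⟩
    m * 1 + C + (a * 1 + triangle a) + (b * 1 + (triangle b + b * r)) + (h ∸ 1) * 2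
      ≡⟨ regroup m a b r (h ∸ 1) C (triangle a) (triangle b) ⟩
    C + m + (triangle a + a) + (triangle b + (b * r + b)) + 2 * (h ∸ 1)
      ≡⟨ sym (+-cong₄ (cong (_+ m) q≡C) (half-triangle a a (expandA a))
                      (half-triangle b (b * r + b) (expandB b r)) refl) ⟩
    q + m + (a * (a + 3)) / 2 + (b * (2 * r + b + 3)) / 2 + 2 * (h ∸ 1) ∎
    where
    open ≡-Reasoning
    regroup : ∀ m a b r H C x y →
      m * 1 + C + (a * 1 + x) + (b * 1 + (y + b * r)) + H * 2 ≡ C + m + (x + a) + (y + (b * r + b)) + 2 * H
    regroup = solve-∀
    expandA : ∀ a → a * (a + 3) ≡ a * suc a + a * 2
    expandA = solve-∀
    expandB : ∀ b r → b * (2 * r + b + 3) ≡ b * suc b + (b * r + b) * 2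
    expandB = solve-∀

  transmission-u₀ : D (U n m d a b) (u0 m a) ≡
    q + ((a * (a ∸ 1)) / 2 + a * m) + (b * (2 * a + 2 * r + b + 1)) / 2 + h * (a + 1)
  transmission-u₀ = begin
    D (U n m d a b) (m + a ∸ 1)                            ≡⟨ cong (D (U n m d a b) ∘ (_∸ 1)) (+-suc m a₀) ⟩
    D (U n m d a b) (m + a₀)                               ≡⟨ trans (D-U _) (D-u₀ (s≤s z≤n)) ⟩
    m * a + C + triangle a₀ + (b * a + (triangle b + b * r)) + h * (a + 1)
      ≡⟨ regroup m a b r h C (triangle a₀) (triangle b) ⟩
    C + (triangle a₀ + 0 + a * m) + (triangle b + (a * b + b * r)) + h * (a + 1)
      ≡⟨ sym (+-cong₄ q≡C (cong (_+ a * m) (half-triangle a₀ 0 (expandA a₀)))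
                      (half-triangle b (a * b + b * r) (expandB a b r)) refl) ⟩
    q + ((a * (a ∸ 1)) / 2 + a * m) + (b * (2 * a + 2 * r + b + 1)) / 2 + h * (a + 1) ∎
    where
    open ≡-Reasoning
    regroup : ∀ m a b r h C x y →
      m * a + C + x + (b * a + (y + b * r)) + h * (a + 1) ≡ C + (x + 0 + a * m) + (y + (a * b + b * r)) + h * (a + 1)
    regroup = solve-∀
    expandA : ∀ a₀ → suc a₀ * a₀ ≡ a₀ * suc a₀ + 0 * 2
    expandA = solve-∀
    expandB : ∀ a b r → b * (2 * a + 2 * r + b + 1) ≡ b * suc b + (a * b + b * r) * 2
    expandB = solve-∀

transmission-u₁ : ∀ n m d a₀ b → 3 ≤ m → 3 ≤ d → d ≤ n ∸ (m + 1) / 2 → suc a₀ + b ≡ d ∸ m / 2 →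
  let a = suc a₀
      r = m / 2
  in D (U n m d a b) (u1 m a b) ≡
     (m * m) / 4 + ((b * (b ∸ 1)) / 2 + b * m) + (a * (2 * b + 2 * r + a + 1)) / 2 + hU n m d * (b + r + 1)
transmission-u₁ n m d a₀ zero 3≤m 3≤d d≤n∸c a+b≡ = begin
  D (U n m d a 0) r                                        ≡⟨ trans (D-U r) D-vᵣ ⟩
  C + (triangle a + a * r) + 0 + h * suc r                 ≡⟨ regroup a r h C (triangle a) ⟩
  C + 0 + (triangle a + a * r) + h * (0 + r + 1)
    ≡⟨ sym (+-cong₄ q≡C refl (half-triangle a (a * r) (expandA a r)) refl) ⟩
  q + 0 + (a * (2 * 0 + 2 * r + a + 1)) / 2 + h * (0 + r + 1) ∎
  where
  open ClosedForms n m d a₀ 0 3≤m 3≤d d≤n∸c a+b≡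
  open ≡-Reasoning
  regroup : ∀ a r h C x → C + (x + a * r) + 0 + h * suc r ≡ C + 0 + (x + a * r) + h * (0 + r + 1)
  regroup = solve-∀
  expandA : ∀ a r → a * (2 * 0 + 2 * r + a + 1) ≡ a * suc a + a * r * 2
  expandA = solve-∀
transmission-u₁ n m d a₀ (suc b₀) 3≤m 3≤d d≤n∸c a+b≡ = begin
  D (U n m d a b) (m + a + b₀)                             ≡⟨ trans (D-U _) (D-u₁ (s≤s z≤n)) ⟩
  m * b + C + (a * b + (triangle a + a * r)) + triangle b₀ + h * (b + suc r)
    ≡⟨ regroup m a b r h C (triangle a) (triangle b₀) ⟩
  C + (triangle b₀ + 0 + b * m) + (triangle a + (a * b + a * r)) + h * (b + r + 1)
    ≡⟨ sym (+-cong₄ q≡C (cong (_+ b * m) (half-triangle b₀ 0 (expandB b₀)))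
                    (half-triangle a (a * b + a * r) (expandA a b r)) refl) ⟩
  q + ((b * b₀) / 2 + b * m) + (a * (2 * b + 2 * r + a + 1)) / 2 + h * (b + r + 1) ∎
  where
  open ClosedForms n m d a₀ (suc b₀) 3≤m 3≤d d≤n∸c a+b≡
  open ≡-Reasoning
  b : ℕ
  b = suc b₀
  regroup : ∀ m a b r h C x y →
    m * b + C + (a * b + (x + a * r)) + y + h * (b + suc r) ≡ C + (y + 0 + b * m) + (x + (a * b + a * r)) + h * (b + r + 1)
  regroup = solve-∀
  expandA : ∀ a b r → a * (2 * b + 2 * r + a + 1) ≡ a * suc a + (a * b + a * r) * 2
  expandA = solve-∀
  expandB : ∀ b₀ → suc b₀ * b₀ ≡ b₀ * suc b₀ + 0 * 2
  expandB = solve-∀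

lemma9 : (n m d a b : ℕ) →
  5 ≤ n → 3 ≤ m → m ≤ n ∸ 1 → 3 ≤ d → d ≤ n ∸ ((m + 1) / 2) →
  b ≤ a → 1 ≤ a → a + b ≡ d ∸ (m / 2) →
  let h = hU n m d
      G = U n m d a b
      r = m / 2
      q = (m * m) / 4
  in (D G (v 0) ≡ q + (a * (a + 1)) / 2 + (b * (b + 1 + 2 * r)) / 2 + h)
   × (D G (v r) ≡ q + (a * (a + 1 + 2 * r)) / 2 + (b * (b + 1)) / 2 + h * (1 + r))
   × ((j : ℕ) → j < h →
        D G (pendant m a b j) ≡ q + m + (a * (a + 3)) / 2 + (b * (2 * r + b + 3)) / 2 + 2 * (h ∸ 1))
   × (D G (u0 m a) ≡ q + ((a * (a ∸ 1)) / 2 + a * m) + (b * (2 * a + 2 * r + b + 1)) / 2 + h * (a + 1))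
   × (D G (u1 m a b) ≡ q + ((b * (b ∸ 1)) / 2 + b * m) + (a * (2 * b + 2 * r + a + 1)) / 2 + h * (b + r + 1))
lemma9 n m d zero     b _ _   _ _   _     _ () _
lemma9 n m d (suc a₀) b _ 3≤m _ 3≤d d≤n∸c _ _  a+b≡ =
  transmission-v₀ , transmission-vᵣ , transmission-leaf , transmission-u₀ ,
  transmission-u₁ n m d a₀ b 3≤m 3≤d d≤n∸c a+b≡
  where open ClosedForms n m d a₀ b 3≤m 3≤d d≤n∸c a+b≡
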